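{- Let $\Delta$ be a finite abstract simplicial complex with $\dim \Delta \geq 1$ whose graph is connected, and let $M$ be a Morse matching of $\Delta$. Let $\Gamma(M)$ be the graph obtained from the graph of $\Delta$ by removing every edge ($1$-face) that is matched in $M$ with a $2$-face; $\Gamma(M)$ has all vertices of $\Delta$ as its nodes. Then $\Gamma(M)$ is connected.
   Context: A finite abstract simplicial complex $\Delta$ on a finite vertex set $V$ is a family of nonempty subsets of $V$ (faces) closed under taking nonempty subsets; $\dim F = |F|-1$, and $\dim\Delta$ is the maximum face dimension. The graph of $\Delta$ has node set $V$, with two vertices adjacent iff they form a $1$-face. For faces $F,G$ write $F \prec G$ if $F \subset G$ and $\dim F = \dim G - 1$. The Hasse diagram $H$ of $\Delta$ is the directed graph on the set of faces with an arc $(G,F)$ whenever $F \prec G$. A matching $M$ in $H$ is a set of arcs such that each face is incident to at most one arc of $M$. Let $H(M)$ be obtained from $H$ by reversing the arcs in $M$. $M$ is a Morse matching if $H(M)$ has no directed cycle. -}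

module Defs where

open import Data.Nat using (ℕ; suc; _≤_; _+_)
open import Data.Bool using (Bool; true; false)
open import Data.Fin using (Fin)
open import Data.Fin.Subset using (Subset; _⊆_; ∣_∣; ⁅_⁆; _∪_; Nonempty)
open import Data.Product using (Σ; ∃; _×_)
open import Relation.Binary.PropositionalEquality using (_≡_; _≢_)
open import Relation.Binary.Construct.Closure.Transitive using (TransClosure)
open import Relation.Binary.Construct.Closure.ReflexiveTransitive using (Star)
open import Relation.Nullary using (¬_)

record SimplicialComplex (n : ℕ) : Set where
  field
    isFace   : Subset n → Bool
    nonempty : ∀ F → isFace F ≡ true → Nonempty F
    closed   : ∀ F G → isFace G ≡ true → Nonempty F → F ⊆ G → isFace F ≡ true
open SimplicialComplex public

module _ {n : ℕ} (Δ : SimplicialComplex n) where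

  Face : Subset n → Set
  Face F = isFace Δ F ≡ true

  -- dim Δ ≥ 1 : some face has at least 2 elements (dim F = |F| - 1).
  DimAtLeast1 : Set
  DimAtLeast1 = Σ (Subset n) λ F → Face F × 2 ≤ ∣ F ∣

  edge : Fin n → Fin n → Subset n
  edge u v = ⁅ u ⁆ ∪ ⁅ v ⁆

  GraphAdj : Fin n → Fin n → Set
  GraphAdj u v = u ≢ v × Face (edge u v)

  _≺_ : Subset n → Subset n → Set
  F ≺ G = Face F × Face G × F ⊆ G × suc ∣ F ∣ ≡ ∣ G ∣

  -- A matching in the Hasse diagram: M F G = true means the arc (G,F) is in M.
  record IsMatching (M : Subset n → Subset n → Bool) : Set where
    field
      arcs : ∀ F G → M F G ≡ true → F ≺ G
      uniqueLow  : ∀ F G F' G' → M F G ≡ true → M F' G' ≡ true → F ≡ F' → G ≡ G'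
      uniqueHigh : ∀ F G F' G' → M F G ≡ true → M F' G' ≡ true → G ≡ G' → F ≡ F'
      noLowHigh  : ∀ F G F' G' → M F G ≡ true → M F' G' ≡ true → ¬ (F ≡ G')

  -- Arcs of H(M): arc (G,F) of H unless matched, in which case reversed to (F,G).
  data ArcHM (M : Subset n → Subset n → Bool) : Subset n → Subset n → Set where
    down : ∀ {F G} → F ≺ G → M F G ≡ false → ArcHM M G F
    up   : ∀ {F G} → F ≺ G → M F G ≡ true  → ArcHM M F G

  Acyclic : (Subset n → Subset n → Bool) → Set
  Acyclic M = ∀ X → ¬ TransClosure (ArcHM M) X X

  record IsMorseMatching (M : Subset n → Subset n → Bool) : Set where
    field
      matching : IsMatching M
      acyclic  : Acyclic M

  GammaAdj : (Subset n → Subset n → Bool) → Fin n → Fin n → Set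
  GammaAdj M u v = GraphAdj u v × ¬ (Σ (Subset n) λ G → M (edge u v) G ≡ true × ∣ G ∣ ≡ 3)

Connected : {n : ℕ} → (Fin n → Fin n → Set) → Set
Connected {n} Adj = ∀ (u v : Fin n) → Star Adj u v

-- If an edge {u,v} is matched with a triangle {u,v,w}, then in H(M) there are paths
-- {u,v} → {u,v,w} → {u,w} and {u,v} → {u,v,w} → {w,v}, so {u,v} can be replaced by the
-- two other sides of its triangle. Repeating this either ends with edges of Γ(M) joining
-- u to v, or produces an arbitrarily long chain of edges, each reachable from the previous
-- one in H(M); a chain longer than the number of ordered pairs of vertices repeats an
-- edge and so closes a directed cycle, contradicting acyclicity.
module Submission where

open import Defs
open import Data.Nat using (ℕ)
open import Data.Bool using (Bool)
open import Data.Fin.Subset using (Subset)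

open import Level using (Level; _⊔_)
open import Data.Nat as ℕ using (zero; suc; _*_; s<s)
open import Data.Nat.Properties using (n<1+n; ≤-reflexive; <⇒≱)
open import Data.Bool using (true; false)
open import Data.Bool.Properties using (_≟_)
open import Data.Fin as Fin using (Fin; zero; suc)
open import Data.Fin.Properties using (any?; pigeonhole; *↔×)
open import Data.Fin.Subset using (_⊆_; _⊂_; _∈_; ∣_∣; ⁅_⁆; _∪_)
open import Data.Fin.Subset.Properties
  using (anySubset?; _∈?_; x∈p∪q⁺; x∈p∪q⁻; x∈⁅x⁆; x∈⁅y⁆⇒x≡y; ∣⁅x⁆∣≡1; ∪-identityˡ; ∪-identityʳ; p⊆q⇒∣p∣≤∣q∣)
open import Data.Product using (∃; _×_; _,_; proj₁)
open import Data.Sum using (_⊎_; inj₁; inj₂)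
open import Data.Empty using (⊥-elim)
open import Function.Base using (_∘_)
open import Function.Bundles using (_↣_; Injection)
open import Function.Properties.Inverse using (↔⇒↣; ↔-sym)
open import Relation.Binary.Core using (Rel)
open import Relation.Binary.Definitions using (Irreflexive; Transitive)
open import Relation.Binary.PropositionalEquality using (_≡_; _≢_; refl; sym; trans; cong; subst)
open import Relation.Binary.Construct.Closure.Transitive using (TransClosure; [_]; _∷_; _++_)
open import Relation.Binary.Construct.Closure.ReflexiveTransitive using (Star; ε; _◅_; _◅◅_; _>>=_)
open import Relation.Nullary using (¬_; yes; no)
open import Relation.Nullary.Decidable using (_×-dec_; ¬?)

module _ {a ℓ : Level} {A : Set a} (_<_ : Rel A ℓ) where

  data Chain : ℕ → A → Set (a ⊔ ℓ) where
    []  : ∀ {x} → Chain 0 x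
    _∷_ : ∀ {k x y} → x < y → Chain k y → Chain (suc k) x

  lookup : ∀ {k x} → Chain k x → Fin (suc k) → A
  lookup {x = x} _       zero    = x
  lookup         (_ ∷ c) (suc i) = lookup c i

  module _ (<-trans : Transitive _<_) where

    head<lookup : ∀ {k x} (c : Chain (suc k) x) (j : Fin (suc k)) → x < lookup c (suc j)
    head<lookup (x<y ∷ _)         zero    = x<y
    head<lookup (x<y ∷ c@(_ ∷ _)) (suc j) = <-trans x<y (head<lookup c j)

    lookup-< : ∀ {k x} (c : Chain k x) {i j : Fin (suc k)} → i Fin.< j → lookup c i < lookup c j
    lookup-< c@(_ ∷ _) {zero}  {suc j} _         = head<lookup c j
    lookup-< (_ ∷ c)   {suc i} {suc j} (s<s i<j) = lookup-< c i<j

    ¬Chain-of-card : Irreflexive _≡_ _<_ → ∀ {m} → A ↣ Fin m → ∀ {x} → ¬ Chain m x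
    ¬Chain-of-card <-irrefl {m} A↣Fin c
      with i , j , i<j , fᵢ≡fⱼ ← pigeonhole (n<1+n m) (Injection.to A↣Fin ∘ lookup c)
      = <-irrefl (Injection.injective A↣Fin fᵢ≡fⱼ) (lookup-< c i<j)

∣⁅x⁆∪⁅y⁆∣≡2 : ∀ {n} {x y : Fin n} → x ≢ y → ∣ ⁅ x ⁆ ∪ ⁅ y ⁆ ∣ ≡ 2
∣⁅x⁆∪⁅y⁆∣≡2 {x = zero}  {zero}  x≢y = ⊥-elim (x≢y refl)
∣⁅x⁆∪⁅y⁆∣≡2 {x = zero}  {suc y} _   = cong suc (trans (cong ∣_∣ (∪-identityˡ ⁅ y ⁆)) (∣⁅x⁆∣≡1 y))
∣⁅x⁆∪⁅y⁆∣≡2 {x = suc x} {zero}  _   = cong suc (trans (cong ∣_∣ (∪-identityʳ ⁅ x ⁆)) (∣⁅x⁆∣≡1 x))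
∣⁅x⁆∪⁅y⁆∣≡2 {x = suc x} {suc y} x≢y = ∣⁅x⁆∪⁅y⁆∣≡2 (x≢y ∘ cong suc)

module _ {n : ℕ} where

  x∈⁅x⁆∪⁅y⁆ : ∀ {x y : Fin n} → x ∈ ⁅ x ⁆ ∪ ⁅ y ⁆
  x∈⁅x⁆∪⁅y⁆ {x} = x∈p∪q⁺ (inj₁ (x∈⁅x⁆ x))

  y∈⁅x⁆∪⁅y⁆ : ∀ {x y : Fin n} → y ∈ ⁅ x ⁆ ∪ ⁅ y ⁆
  y∈⁅x⁆∪⁅y⁆ {y = y} = x∈p∪q⁺ (inj₂ (x∈⁅x⁆ y))

  ⁅x⁆∪⁅y⁆⊆p : ∀ {x y : Fin n} {p : Subset n} → x ∈ p → y ∈ p → ⁅ x ⁆ ∪ ⁅ y ⁆ ⊆ p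
  ⁅x⁆∪⁅y⁆⊆p {x} {y} {p} x∈p y∈p z∈xy with x∈p∪q⁻ ⁅ x ⁆ ⁅ y ⁆ z∈xy
  ... | inj₁ z∈⁅x⁆ = subst (_∈ p) (sym (x∈⁅y⁆⇒x≡y x z∈⁅x⁆)) x∈p
  ... | inj₂ z∈⁅y⁆ = subst (_∈ p) (sym (x∈⁅y⁆⇒x≡y y z∈⁅y⁆)) y∈p

  p⊆q∧∣p∣<∣q∣⇒p⊂q : ∀ {p q : Subset n} → p ⊆ q → ∣ p ∣ ℕ.< ∣ q ∣ → p ⊂ q
  p⊆q∧∣p∣<∣q∣⇒p⊂q {p} {q} p⊆q ∣p∣<∣q∣ with any? (λ x → (x ∈? q) ×-dec ¬? (x ∈? p))
  ... | yes q∖p-nonempty = p⊆q , q∖p-nonempty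
  ... | no  q∖p-empty    = ⊥-elim (<⇒≱ ∣p∣<∣q∣ (p⊆q⇒∣p∣≤∣q∣ q⊆p))
    where
    q⊆p : q ⊆ p
    q⊆p {x} x∈q with x ∈? p
    ... | yes x∈p = x∈p
    ... | no  x∉p = ⊥-elim (q∖p-empty (x , x∈q , x∉p))

module _ {n : ℕ} (Δ : SimplicialComplex n) (M : Subset n → Subset n → Bool)
         (morse : IsMorseMatching Δ M) where
  open IsMorseMatching morse
  open IsMatching matching

  _⇝⁺_ : Rel (Subset n) _
  _⇝⁺_ = TransClosure (ArcHM Δ M)

  ⇝⁺-other-facet : ∀ {F F′ G} → M F G ≡ true → _≺_ Δ F′ G → F′ ≢ F → F ⇝⁺ F′
  ⇝⁺-other-facet {F} {F′} {G} F-G F′≺G F′≢F with M F′ G in F′-G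
  ... | true  = ⊥-elim (F′≢F (uniqueHigh _ _ _ _ F′-G F-G refl))
  ... | false = up (arcs _ _ F-G) F-G ∷ [ down F′≺G F′-G ]

  edge≺triangle : ∀ {G a b} → Face Δ G → ∣ G ∣ ≡ 3 → a ∈ G → b ∈ G → a ≢ b → _≺_ Δ (edge Δ a b) G
  edge≺triangle {G} {a} {b} G-face ∣G∣≡3 a∈G b∈G a≢b =
    ab-face , G-face , ab⊆G , trans (cong suc (∣⁅x⁆∪⁅y⁆∣≡2 a≢b)) (sym ∣G∣≡3)
    where
    ab⊆G = ⁅x⁆∪⁅y⁆⊆p a∈G b∈G
    ab-face : Face Δ (edge Δ a b)
    ab-face = closed Δ _ G G-face (a , x∈⁅x⁆∪⁅y⁆) ab⊆G

  -- Oriented edges, so that they can be counted by Fin n × Fin n.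
  _↝_ : Rel (Fin n × Fin n) _
  (u , v) ↝ (a , b) = edge Δ u v ⇝⁺ edge Δ a b

  matched-edge⇒apex : ∀ {u v G} → GraphAdj Δ u v → M (edge Δ u v) G ≡ true →
                      ∃ λ w → (GraphAdj Δ u w × (u , v) ↝ (u , w)) × (GraphAdj Δ w v × (u , v) ↝ (w , v))
  matched-edge⇒apex {u} {v} {G} (u≢v , _) uv-G with arcs _ _ uv-G
  ... | _ , G-face , uv⊆G , ∣uv∣+1≡∣G∣ with p⊆q∧∣p∣<∣q∣⇒p⊂q uv⊆G (≤-reflexive ∣uv∣+1≡∣G∣)
  ... | _ , w , w∈G , w∉uv =
    w , side (uv⊆G x∈⁅x⁆∪⁅y⁆) w∈G u≢w y∈⁅x⁆∪⁅y⁆ , side w∈G (uv⊆G y∈⁅x⁆∪⁅y⁆) w≢v x∈⁅x⁆∪⁅y⁆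
    where
    ∣G∣≡3 : ∣ G ∣ ≡ 3
    ∣G∣≡3 = trans (sym ∣uv∣+1≡∣G∣) (cong suc (∣⁅x⁆∪⁅y⁆∣≡2 u≢v))

    u≢w : u ≢ w
    u≢w refl = w∉uv x∈⁅x⁆∪⁅y⁆

    w≢v : w ≢ v
    w≢v refl = w∉uv y∈⁅x⁆∪⁅y⁆

    side : ∀ {a b} → a ∈ G → b ∈ G → a ≢ b → w ∈ edge Δ a b → GraphAdj Δ a b × (u , v) ↝ (a , b)
    side a∈G b∈G a≢b w∈ab = (a≢b , proj₁ ab≺G) , ⇝⁺-other-facet uv-G ab≺G ab≢uv
      where
      ab≺G = edge≺triangle G-face ∣G∣≡3 a∈G b∈G a≢b
      ab≢uv = λ ab≡uv → w∉uv (subst (w ∈_) ab≡uv w∈ab)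

  Γ-path-or-Chain : ∀ k {u v} → GraphAdj Δ u v → Star (GammaAdj Δ M) u v ⊎ Chain _↝_ k (u , v)
  Γ-path-or-Chain zero    _ = inj₂ []
  Γ-path-or-Chain (suc k) {u} {v} uv with anySubset? (λ G → M (edge Δ u v) G ≟ true)
  ... | no  unmatched = inj₁ ((uv , λ (G , uv-G , _) → unmatched (G , uv-G)) ◅ ε)
  ... | yes (G , uv-G) with matched-edge⇒apex uv uv-G
  ... | w , (uw , uv↝uw) , (wv , uv↝wv) = join (Γ-path-or-Chain k uw) (Γ-path-or-Chain k wv)
    where
    join : Star (GammaAdj Δ M) u w ⊎ Chain _↝_ k (u , w) → Star (GammaAdj Δ M) w v ⊎ Chain _↝_ k (w , v) →
           Star (GammaAdj Δ M) u v ⊎ Chain _↝_ (suc k) (u , v)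
    join (inj₁ u⋯w) (inj₁ w⋯v) = inj₁ (u⋯w ◅◅ w⋯v)
    join (inj₂ c)   _          = inj₂ (uv↝uw ∷ c)
    join (inj₁ _)   (inj₂ c)   = inj₂ (uv↝wv ∷ c)

  ↝-trans : Transitive _↝_
  ↝-trans = _++_

  ↝-irrefl : Irreflexive _≡_ _↝_
  ↝-irrefl refl = acyclic _

  GraphAdj⇒Γ-path : ∀ {u v} → GraphAdj Δ u v → Star (GammaAdj Δ M) u v
  GraphAdj⇒Γ-path uv with Γ-path-or-Chain (n * n) uv
  ... | inj₁ path  = path
  ... | inj₂ chain = ⊥-elim (¬Chain-of-card _↝_ ↝-trans ↝-irrefl (↔⇒↣ (↔-sym *↔×)) chain)

lemma4p2 : (n : ℕ) (Δ : SimplicialComplex n) → DimAtLeast1 Δ → Connected (GraphAdj Δ) →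
    (M : Subset n → Subset n → Bool) → IsMorseMatching Δ M →
    Connected (GammaAdj Δ M)
lemma4p2 n Δ _ connected M morse u v = connected u v >>= GraphAdj⇒Γ-path Δ M morse
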